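{- Let $\mathcal M=(\mathbf A,\perp,\{\mathsf t,\mathsf f\})$ be an $\mathfrak{N}_w$-model and let $x,y$ be distinct propositional variables. Then $\mathcal M\models(x\Rightarrow y)\Rightarrow(y\Rightarrow x)$ if and only if $\mathbf A$ is trivial (has exactly one element).
   Context: Abbreviations (for formulas and elements of algebras of type $(\otimes,\circ,{}^{*})$): $u\Rightarrow v:=(u\circ v^{*})^{*}$; $u\Leftrightarrow v:=(u\Rightarrow v)\otimes(v\Rightarrow u)$; $u\not\Leftrightarrow v:=(u\Leftrightarrow v)^{*}$; $u\not\Leftrightarrow v\not\Leftrightarrow w:=((u\not\Leftrightarrow v)\otimes(u\not\Leftrightarrow w))\otimes(v\not\Leftrightarrow w)$. A weak $\mathcal{N}$-algebra is $\mathbf A=(A,\otimes,\circ,{}^{*})$ with $\otimes,\circ$ commutative, $x^{**}=x$, $(x\otimes y)\circ z=(x\otimes z)\circ y$. Fix distinct $\mathsf t,\mathsf f\notin A$, $\overline A=A\cup\{\mathsf t,\mathsf f\}$. An $\mathfrak{N}_{w}$-model is $(\mathbf A,\perp,\{\mathsf t,\mathsf f\})$ with $\mathbf A$ a weak $\mathcal N$-algebra, $\perp\subseteq\overline A\times\overline A$, and for all $x,y,z\in A$: (a) $x\perp x^{*}$; (b) $x\perp y^{*}$ and $y\perp x^{*}$ imply $x=y$; (c) $x\perp y$ iff $x\circ y\perp\mathsf t$; (d) $x\perp\mathsf t$ iff $x^{*}\perp\mathsf f$; (e) $x\perp\mathsf f$ and $y\perp\mathsf f$ iff $x\otimes y\perp\mathsf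 f$; (f) $(x\circ y^{*})^{*}\perp(x\circ y)^{*}$; (g) $x\perp y$ and $x\perp\mathsf f$ imply $y\perp\mathsf t$; (h) $x\not\Leftrightarrow y\not\Leftrightarrow z\perp((x\Rightarrow y)\Rightarrow((y\Rightarrow z)\Rightarrow(x\Rightarrow z)))^{*}$. For a formula $\varphi$, $\mathcal M\models\varphi$ means $h(\varphi)\perp\mathsf f$ for every homomorphism $h$ from the formula algebra to $\mathbf A$. -}

module Defs where

open import Level using (Level; _⊔_; suc)
open import Data.Nat using (ℕ)
open import Data.Product using (_×_; Σ)
open import Relation.Binary.PropositionalEquality using (_≡_)

-- Weak N-algebras (A, ⊗, ∘, *).  As usual in universal algebra the
-- carrier is required to be nonempty (field 'inhabitant').
record WeakNAlgebra (a : Level) : Set (suc a) where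
  infixl 7 _⊗_
  infixl 6 _∘_
  field
    Carrier    : Set a
    _⊗_        : Carrier → Carrier → Carrier
    _∘_        : Carrier → Carrier → Carrier
    _*         : Carrier → Carrier
    inhabitant : Carrier
    ⊗-comm     : ∀ x y → x ⊗ y ≡ y ⊗ x
    ∘-comm     : ∀ x y → x ∘ y ≡ y ∘ x
    *-invol    : ∀ x → (x *) * ≡ x
    ⊗∘-exch    : ∀ x y z → (x ⊗ y) ∘ z ≡ (x ⊗ z) ∘ y

  _⇒_ : Carrier → Carrier → Carrier
  u ⇒ v = (u ∘ (v *)) *

  _⇔_ : Carrier → Carrier → Carrier
  u ⇔ v = (u ⇒ v) ⊗ (v ⇒ u)

  _⇎_ : Carrier → Carrier → Carrier
  u ⇎ v = (u ⇔ v) *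

  ⇎3 : Carrier → Carrier → Carrier → Carrier
  ⇎3 u v w = ((u ⇎ v) ⊗ (u ⇎ w)) ⊗ (v ⇎ w)

data Ext {a : Level} (A : Set a) : Set a where
  el : A → Ext A
  𝗍  : Ext A
  𝖿  : Ext A

record NwModel (a ℓ : Level) : Set (suc (a ⊔ ℓ)) where
  field
    alg : WeakNAlgebra a
  open WeakNAlgebra alg public
  field
    _⊥_ : Ext Carrier → Ext Carrier → Set ℓ
    ax-a : ∀ x → el x ⊥ el (x *)
    ax-b : ∀ x y → el x ⊥ el (y *) → el y ⊥ el (x *) → x ≡ y
    ax-c₁ : ∀ x y → el x ⊥ el y → el (x ∘ y) ⊥ 𝗍
    ax-c₂ : ∀ x y → el (x ∘ y) ⊥ 𝗍 → el x ⊥ el y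
    ax-d₁ : ∀ x → el x ⊥ 𝗍 → el (x *) ⊥ 𝖿
    ax-d₂ : ∀ x → el (x *) ⊥ 𝖿 → el x ⊥ 𝗍
    ax-e₁ : ∀ x y → el x ⊥ 𝖿 → el y ⊥ 𝖿 → el (x ⊗ y) ⊥ 𝖿
    ax-e₂ : ∀ x y → el (x ⊗ y) ⊥ 𝖿 → el x ⊥ 𝖿 × el y ⊥ 𝖿
    ax-f : ∀ x y → el ((x ∘ (y *)) *) ⊥ el ((x ∘ y) *)
    ax-g : ∀ x y → el x ⊥ el y → el x ⊥ 𝖿 → el y ⊥ 𝗍
    ax-h : ∀ x y z →
      el (⇎3 x y z) ⊥ el (((x ⇒ y) ⇒ ((y ⇒ z) ⇒ (x ⇒ z))) *)

infixl 7 _⊗ᶠ_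
infixl 6 _∘ᶠ_
data Formula : Set where
  var   : ℕ → Formula
  _⊗ᶠ_  : Formula → Formula → Formula
  _∘ᶠ_  : Formula → Formula → Formula
  _*ᶠ   : Formula → Formula

_⇒ᶠ_ : Formula → Formula → Formula
u ⇒ᶠ v = (u ∘ᶠ (v *ᶠ)) *ᶠ

record Hom {a : Level} (𝐀 : WeakNAlgebra a) : Set a where
  open WeakNAlgebra 𝐀
  field
    h     : Formula → Carrier
    h-⊗   : ∀ φ ψ → h (φ ⊗ᶠ ψ) ≡ h φ ⊗ h ψ
    h-∘   : ∀ φ ψ → h (φ ∘ᶠ ψ) ≡ h φ ∘ h ψ
    h-*   : ∀ φ → h (φ *ᶠ) ≡ (h φ) *

_⊨_ : ∀ {a ℓ} → NwModel a ℓ → Formula → Set (a ⊔ ℓ)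
M ⊨ φ = (H : Hom (NwModel.alg M)) → NwModel._⊥_ M (el (Hom.h H φ)) 𝖿

Trivial : ∀ {a} → WeakNAlgebra a → Set a
Trivial 𝐀 = Σ (WeakNAlgebra.Carrier 𝐀) λ c → ∀ d → d ≡ c

{-# OPTIONS --safe #-}
module Submission where

open import Defs
open import Level using (Level)
open import Data.Bool using (if_then_else_)
open import Data.Nat using (ℕ; _≟_)
open import Data.Product using (_,_; proj₁)
open import Function.Bundles using (_⇔_; mk⇔)
open import Relation.Nullary using (¬_; does)
open import Relation.Nullary.Decidable using (dec-true; dec-false)
open import Relation.Binary.PropositionalEquality
  using (_≡_; _≢_; ≢-sym; refl; sym; trans; cong; cong₂; subst; module ≡-Reasoning)

-- Validity of the swap schema makes (p ⇒ q) ⇒ (q ⇒ p) designated for all p, q,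
-- so axioms (c), (d) and (b) give p ⇒ q = q ⇒ p, and with (c) again
-- el p ⊥ el (q *) forces p = q.  For the designated v = i ⇒ i, axiom (a) and
-- the exchange law then yield p ⊗ (p ⊗ v *) * = v, so every p is designated by
-- (e); designatedness of d ⇒ i finally gives d = i.  Conversely, in a trivial
-- algebra every element equals the designated i ⇒ i.

module _ {a ℓ : Level} (M : NwModel a ℓ) where
  open NwModel M

  Designated : Carrier → Set ℓ
  Designated p = el p ⊥ 𝖿

  eval : (ℕ → Carrier) → Formula → Carrier
  eval ρ (var n)  = ρ n
  eval ρ (φ ⊗ᶠ ψ) = eval ρ φ ⊗ eval ρ ψ
  eval ρ (φ ∘ᶠ ψ) = eval ρ φ ∘ eval ρ ψ
  eval ρ (φ *ᶠ)   = eval ρ φ *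

  evalHom : (ℕ → Carrier) → Hom alg
  evalHom ρ = record
    { h   = eval ρ
    ; h-⊗ = λ _ _ → refl
    ; h-∘ = λ _ _ → refl
    ; h-* = λ _ → refl
    }

  ⊨⇒designated : ∀ {φ} → M ⊨ φ → ∀ ρ → Designated (eval ρ φ)
  ⊨⇒designated ⊨φ ρ = ⊨φ (evalHom ρ)

  pointAt : ℕ → Carrier → Carrier → ℕ → Carrier
  pointAt x p q n = if does (n ≟ x) then p else q

  pointAt-at : ∀ x p q → pointAt x p q x ≡ p
  pointAt-at x p q rewrite dec-true (x ≟ x) refl = refl

  pointAt-off : ∀ {x y} p q → y ≢ x → pointAt x p q y ≡ q
  pointAt-off {x} {y} p q y≢x rewrite dec-false (y ≟ x) y≢x = refl

  *-injective : ∀ {p q} → p * ≡ q * → p ≡ q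
  *-injective {p} {q} p*≡q* = begin
    p       ≡⟨ sym (*-invol p) ⟩
    p * *   ≡⟨ cong _* p*≡q* ⟩
    q * *   ≡⟨ *-invol q ⟩
    q       ∎
    where open ≡-Reasoning

  ⇒-refl-designated : ∀ p → Designated (p ⇒ p)
  ⇒-refl-designated p = ax-d₁ (p ∘ p *) (ax-c₁ p (p *) (ax-a p))

  designated-⇒⇒⊥* : ∀ p q → Designated (p ⇒ q) → el p ⊥ el (q *)
  designated-⇒⇒⊥* p q ⊢p⇒q = ax-c₂ p (q *) (ax-d₂ (p ∘ q *) ⊢p⇒q)

  trivial⇒designated : Trivial alg → ∀ p → Designated p
  trivial⇒designated (c , ≡c) p =
    subst Designated (trans (≡c (c ⇒ c)) (sym (≡c p))) (⇒-refl-designated c)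

  ⇒-swap-designated⇒⊥*-injective :
    (∀ p q → Designated ((p ⇒ q) ⇒ (q ⇒ p))) → ∀ p q → el p ⊥ el (q *) → p ≡ q
  ⇒-swap-designated⇒⊥*-injective swap p q p⊥q* =
    ax-b p q p⊥q* (ax-c₂ q (p *) (subst (λ z → el z ⊥ 𝗍) ∘*-swap (ax-c₁ p (q *) p⊥q*)))
    where
    ⇒-comm : ∀ r s → r ⇒ s ≡ s ⇒ r
    ⇒-comm r s = ax-b (r ⇒ s) (s ⇒ r)
      (designated-⇒⇒⊥* _ _ (swap r s)) (designated-⇒⇒⊥* _ _ (swap s r))

    ∘*-swap : p ∘ q * ≡ q ∘ p *
    ∘*-swap = *-injective (⇒-comm p q)

  ⊥*-injective⇒trivial : (∀ p q → el p ⊥ el (q *) → p ≡ q) → Trivial alg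
  ⊥*-injective⇒trivial ⊥*⇒≡ = i , λ d → ⊥*⇒≡ d i (designated-⇒⇒⊥* d i (all-designated (d ⇒ i)))
    where
    i : Carrier
    i = inhabitant

    v : Carrier
    v = i ⇒ i

    all-designated : ∀ p → Designated p
    all-designated p = proj₁ (ax-e₂ p r (subst Designated (sym p⊗r≡v) (⇒-refl-designated i)))
      where
      r : Carrier
      r = (p ⊗ v *) *

      p⊗r∘v*⊥t : el ((p ⊗ r) ∘ v *) ⊥ 𝗍
      p⊗r∘v*⊥t = subst (λ z → el z ⊥ 𝗍) (⊗∘-exch p (v *) r) (ax-c₁ _ _ (ax-a (p ⊗ v *)))

      p⊗r≡v : p ⊗ r ≡ v
      p⊗r≡v = ⊥*⇒≡ _ _ (ax-c₂ _ _ p⊗r∘v*⊥t)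

proposition4p13 : ∀ {a ℓ : Level} (M : NwModel a ℓ) (x y : ℕ) → ¬ (x ≡ y) →
    (M ⊨ ((var x ⇒ᶠ var y) ⇒ᶠ (var y ⇒ᶠ var x))) ⇔ Trivial (NwModel.alg M)
proposition4p13 M x y x≢y = mk⇔
  (λ ⊨swap → ⊥*-injective⇒trivial M (⇒-swap-designated⇒⊥*-injective M (swap ⊨swap)))
  (λ trivial _ → trivial⇒designated M trivial _)
  where
  open NwModel M using (_⇒_)

  swap : M ⊨ ((var x ⇒ᶠ var y) ⇒ᶠ (var y ⇒ᶠ var x)) →
         ∀ p q → Designated M ((p ⇒ q) ⇒ (q ⇒ p))
  swap ⊨swap p q = subst (Designated M)
    (cong₂ (λ u w → (u ⇒ w) ⇒ (w ⇒ u)) (pointAt-at M x p q) (pointAt-off M p q (≢-sym x≢y)))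
    (⊨⇒designated M ⊨swap (pointAt M x p q))
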